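{- Let $G$ be a graph and $T$ be a subset of $V(G)$. If $|T|\leq 2$, then $\mathcal{G}(G,T)$ is the cycle matroid of the graph obtained from $G$ by identifying all vertices in $T$; that is, the feasible sets of $(G,T)$ are exactly the bases of the cycle matroid of that graph.
   Context: Graphs are finite and may have loops and parallel edges. A graft is a pair $(G,T)$ of a graph $G$ and a subset $T\subseteq V(G)$. A subgraph $H$ of $G$ is $T$-spanning if $V(H)=V(G)$ and every component $C$ of $H$ satisfies either (i) $|V(C)\cap T|$ is odd, or (ii) $V(C)\cap T=\emptyset$ and $G[V(C)]$ is a component of $G$. A set $F\subseteq E(G)$ is feasible in $(G,T)$ if it is the edge set of a $T$-spanning forest of $G$, and $\mathcal{G}(G,T)$ denotes the delta-matroid $(E(G),\mathcal{F})$ where $\mathcal{F}$ is the set of all feasible sets of $(G,T)$. The cycle matroid of a graph is the matroid on its edge set whose bases are the edge sets of maximal spanning forests. -}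

module Defs where

open import Data.Nat using (ℕ; _%_)
open import Data.Fin using (Fin)
open import Data.Fin.Subset using (Subset; _∈_; _∉_; _-_; _∪_; ⁅_⁆) renaming (⊤ to full)
open import Data.Product using (Σ; ∃; _×_; proj₁; proj₂)
open import Data.Sum using (_⊎_)
open import Data.List using (List; length)
open import Data.List.Relation.Unary.Unique.Propositional using (Unique)
import Data.List.Membership.Propositional as LM
open import Relation.Binary.PropositionalEquality using (_≡_)
open import Relation.Nullary using (¬_)
open import Function.Bundles using (_⇔_)

-- A (finite multi)graph: vertices Fin n, edges Fin m, each edge e has an
-- ordered pair of ends (loops and parallel edges allowed).
record Graph : Set where
  field
    n    : ℕ
    m    : ℕ
    ends : Fin m → Fin n × Fin n
open Graph public

-- Vertices are compared up to a relation _≈_ (an equivalence); this lets us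
-- model the quotient graph G/T (vertices of T identified) as a setoid graph.
VRel : Graph → Set₁
VRel G = Fin (n G) → Fin (n G) → Set

data Reach (G : Graph) (_≈_ : VRel G) (F : Subset (m G)) : Fin (n G) → Fin (n G) → Set where
  here  : ∀ {u v} → u ≈ v → Reach G _≈_ F u v
  fwd   : ∀ {u v} (e : Fin (m G)) → e ∈ F → u ≈ proj₁ (ends G e) →
          Reach G _≈_ F (proj₂ (ends G e)) v → Reach G _≈_ F u v
  bwd   : ∀ {u v} (e : Fin (m G)) → e ∈ F → u ≈ proj₂ (ends G e) →
          Reach G _≈_ F (proj₁ (ends G e)) v → Reach G _≈_ F u v

-- F is (the edge set of) a spanning forest: it contains no cycle, i.e. no
-- edge of F has its ends joined by a walk in F minus that edge (this also
-- excludes loops).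
Forest : (G : Graph) → VRel G → Subset (m G) → Set
Forest G _≈_ F = ∀ e → e ∈ F →
  ¬ Reach G _≈_ (F - e) (proj₁ (ends G e)) (proj₂ (ends G e))

CycleBasis : (G : Graph) → VRel G → Subset (m G) → Set
CycleBasis G _≈_ F = Forest G _≈_ F × (∀ e → e ∉ F → ¬ Forest G _≈_ (F ∪ ⁅ e ⁆))

-- Graph G/T obtained by identifying all vertices of T: same edges/ends,
-- vertex equality u ≈ v iff u ≡ v or both u, v ∈ T.
IdentT : (G : Graph) → Subset (n G) → VRel G
IdentT G T u v = (u ≡ v) ⊎ (u ∈ T × v ∈ T)

module _ (G : Graph) (T : Subset (n G)) (F : Subset (m G)) where
  private
    R : Fin (n G) → Fin (n G) → Set
    R = Reach G _≡_ F

  -- the component of H = (V(G), F) containing v has an odd number of T-vertices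
  OddT : Fin (n G) → Set
  OddT v = Σ (List (Fin (n G))) λ L → Unique L ×
             (∀ w → (w LM.∈ L) ⇔ (w ∈ T × R v w)) × (length L % 2 ≡ 1)

  NoT : Fin (n G) → Set
  NoT v = ∀ w → w ∈ T → ¬ R v w

  -- G[V(C)] is a component of G, where C is the component of H containing v
  IsGComponent : Fin (n G) → Set
  IsGComponent v = ∀ w → Reach G _≡_ full v w → R v w

  TSpanning : Set
  TSpanning = ∀ v → OddT v ⊎ (NoT v × IsGComponent v)

  Feasible : Set
  Feasible = Forest G _≡_ F × TSpanning

-- A forest of G/T is a forest of G no component of which contains two
-- vertices of T, and it is maximal iff every edge of G joins two vertices
-- that are connected in the forest or that both reach T.  When ∣T∣ ≤ 2, a
-- component meets T an odd number of times iff it meets T exactly once, and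
-- given that, the maximality condition says precisely that every component
-- avoiding T is a component of G: these are the two clauses of T-spanning.
module Submission where

open import Defs
open import Data.Nat using (_≤_; _%_; s≤s; z≤n)
open import Data.Nat.Properties using (≤-trans)
open import Data.Fin using (Fin) renaming (_≟_ to _≟ᶠ_)
open import Data.Fin.Subset
  using (Subset; ∣_∣; _∈_; _∉_; _⊆_; _⊂_; _─_; _-_; _∪_; ⁅_⁆; Empty; inside; outside)
  renaming (⊤ to full)
open import Data.Fin.Subset.Properties
  using (_∈?_; nonempty?; x∈p⇒p-x⊂p; x∈p⇒∣p-x∣<∣p∣; x∈p∧x≢y⇒x∈p-y; p─q⊆p;
         x∈p∪q⁻; x∈p∪q⁺; ∈⊤; x∈⁅x⁆; x∈⁅y⁆⇒x≡y; x∉⁅y⁆⇒x≢y)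
open import Data.Fin.Subset.Induction using (⊂-wellFounded; Acc; acc)
open import Data.Fin.Properties using (any?)
open import Data.Product using (∃; _×_; _,_; proj₁; proj₂)
open import Data.Sum using (_⊎_; inj₁; inj₂)
open import Data.Empty using (⊥-elim)
open import Data.List using (List; []; _∷_; length)
open import Data.List.Relation.Unary.Any using (here; there)
open import Data.List.Relation.Unary.All using ([])
open import Data.List.Relation.Unary.AllPairs using ([]; _∷_)
open import Data.List.Relation.Unary.Unique.Propositional using (Unique)
open import Data.List.Membership.Propositional using () renaming (_∈_ to _∈ₗ_)
import Data.List.Relation.Unary.All as All
import Data.Vec as Vec
open import Relation.Binary.Core using (_⇒_)
open import Relation.Binary.Definitions using (Symmetric; Transitive; Decidable)
open import Relation.Binary.Structures using (IsEquivalence)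
open import Relation.Binary.PropositionalEquality using (_≡_; _≢_; refl; sym; isEquivalence)
open import Relation.Nullary using (¬_; Dec; yes; no)
open import Relation.Nullary.Decidable using (map′; _×-dec_; _⊎-dec_)
open import Function.Bundles using (_⇔_; mk⇔; Equivalence)
open Equivalence using (to; from)

x∈p─q⇒x∉q : ∀ {k} (p q : Subset k) {x} → x ∈ p ─ q → x ∉ q
x∈p─q⇒x∉q (inside Vec.∷ _) (outside Vec.∷ _) Vec.here = λ ()
x∈p─q⇒x∉q (_ Vec.∷ p) (_ Vec.∷ q) (Vec.there x∈) (Vec.there x∈q) = x∈p─q⇒x∉q p q x∈ x∈q

x∈p-y⇒x≢y : ∀ {k} {p : Subset k} {x y} → x ∈ p - y → x ≢ y
x∈p-y⇒x≢y {p = p} {y = y} x∈ = x∉⁅y⁆⇒x≢y (x∈p─q⇒x∉q p ⁅ y ⁆ x∈)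

p⊆q⇒p-x⊆q-x : ∀ {k} {p q : Subset k} {x} → p ⊆ q → p - x ⊆ q - x
p⊆q⇒p-x⊆q-x {p = p} {x = x} p⊆q y∈ =
  x∈p∧x≢y⇒x∈p-y (p⊆q (p─q⊆p p ⁅ x ⁆ y∈)) (x∈p-y⇒x≢y y∈)

p⊆p-x∪⁅x⁆ : ∀ {k} {p : Subset k} {x} → p ⊆ (p - x) ∪ ⁅ x ⁆
p⊆p-x∪⁅x⁆ {x = x} {y} y∈ with y ≟ᶠ x
... | yes refl = x∈p∪q⁺ (inj₂ (x∈⁅x⁆ x))
... | no y≢x   = x∈p∪q⁺ (inj₁ (x∈p∧x≢y⇒x∈p-y y∈ y≢x))

p∪⁅x⁆-y⊆p-y∪⁅x⁆ : ∀ {k} {p : Subset k} {x y} → (p ∪ ⁅ x ⁆) - y ⊆ (p - y) ∪ ⁅ x ⁆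
p∪⁅x⁆-y⊆p-y∪⁅x⁆ {p = p} {x} {y} z∈ with x∈p∪q⁻ p ⁅ x ⁆ (p─q⊆p _ ⁅ y ⁆ z∈)
... | inj₁ z∈p = x∈p∪q⁺ (inj₁ (x∈p∧x≢y⇒x∈p-y z∈p (x∈p-y⇒x≢y z∈)))
... | inj₂ z≡x = x∈p∪q⁺ (inj₂ z≡x)

p∪⁅x⁆-x⊆p : ∀ {k} {p : Subset k} {x} → (p ∪ ⁅ x ⁆) - x ⊆ p
p∪⁅x⁆-x⊆p {p = p} {x} y∈ with x∈p∪q⁻ p ⁅ x ⁆ (p─q⊆p _ ⁅ x ⁆ y∈)
... | inj₁ y∈p = y∈p
... | inj₂ y∈⁅x⁆ = ⊥-elim (x∈p-y⇒x≢y y∈ (x∈⁅y⁆⇒x≡y x y∈⁅x⁆))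

x∉p⇒p⊆p∪⁅x⁆-x : ∀ {k} {p : Subset k} {x} → x ∉ p → p ⊆ (p ∪ ⁅ x ⁆) - x
x∉p⇒p⊆p∪⁅x⁆-x x∉p y∈p = x∈p∧x≢y⇒x∈p-y (x∈p∪q⁺ (inj₁ y∈p)) λ { refl → x∉p y∈p }

removal-induction : ∀ {k ℓ} (P : Subset k → Set ℓ) →
  (∀ {p} → Empty p → P p) → (∀ {p x} → x ∈ p → P (p - x) → P p) → ∀ p → P p
removal-induction P empty step p = go p (⊂-wellFounded p)
  where
  go : ∀ p → Acc _⊂_ p → P p
  go p (acc rec) with nonempty? p
  ... | yes (x , x∈p) = step x∈p (go (p - x) (rec (x∈p⇒p-x⊂p x∈p)))
  ... | no ¬nonempty  = empty ¬nonempty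

length≤∣p∣ : ∀ {k} (p : Subset k) {xs : List (Fin k)} → Unique xs →
  (∀ {x} → x ∈ₗ xs → x ∈ p) → length xs ≤ ∣ p ∣
length≤∣p∣ p {[]} _ _ = z≤n
length≤∣p∣ p {x ∷ xs} (x∉xs ∷ unique) xs⊆p =
  ≤-trans (s≤s (length≤∣p∣ (p - x) unique xs⊆p-x)) (x∈p⇒∣p-x∣<∣p∣ (xs⊆p (here refl)))
  where
  xs⊆p-x : ∀ {y} → y ∈ₗ xs → y ∈ p - x
  xs⊆p-x y∈ = x∈p∧x≢y⇒x∈p-y (xs⊆p (there y∈)) λ { refl → All.lookup x∉xs y∈ refl }

∈-odd-length≤2⇒≡ : ∀ {A : Set} {xs : List A} {x y} →
  length xs ≤ 2 → length xs % 2 ≡ 1 → x ∈ₗ xs → y ∈ₗ xs → x ≡ y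
∈-odd-length≤2⇒≡ {xs = _ ∷ []} _ _ (here refl) (here refl) = refl
∈-odd-length≤2⇒≡ {xs = _ ∷ _ ∷ []} _ ()
∈-odd-length≤2⇒≡ {xs = _ ∷ _ ∷ _ ∷ _} (s≤s (s≤s ()))

module _ (G : Graph) where

  src tgt : Fin (m G) → Fin (n G)
  src e = proj₁ (ends G e)
  tgt e = proj₂ (ends G e)

  Spans : VRel G → Subset (m G) → Set
  Spans _≈_ F = ∀ e → Reach G _≈_ F (src e) (tgt e)

  Reach-map : ∀ {_≈_ _≈′_ : VRel G} {F F′} → _≈_ ⇒ _≈′_ → F ⊆ F′ →
    Reach G _≈_ F ⇒ Reach G _≈′_ F′
  Reach-map ≈⇒≈′ F⊆F′ (here u≈v)         = here (≈⇒≈′ u≈v)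
  Reach-map ≈⇒≈′ F⊆F′ (fwd e e∈ u≈ rest) = fwd e (F⊆F′ e∈) (≈⇒≈′ u≈) (Reach-map ≈⇒≈′ F⊆F′ rest)
  Reach-map ≈⇒≈′ F⊆F′ (bwd e e∈ u≈ rest) = bwd e (F⊆F′ e∈) (≈⇒≈′ u≈) (Reach-map ≈⇒≈′ F⊆F′ rest)

  Reach-elim : ∀ {_≈_ _∼_ : VRel G} {F} → Symmetric _∼_ → Transitive _∼_ → _≈_ ⇒ _∼_ →
    (∀ {e} → e ∈ F → src e ∼ tgt e) → Reach G _≈_ F ⇒ _∼_
  Reach-elim sym trans ≈⇒∼ edge (here u≈v) = ≈⇒∼ u≈v
  Reach-elim sym trans ≈⇒∼ edge (fwd e e∈ u≈ rest) =
    trans (≈⇒∼ u≈) (trans (edge e∈) (Reach-elim sym trans ≈⇒∼ edge rest))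
  Reach-elim sym trans ≈⇒∼ edge (bwd e e∈ u≈ rest) =
    trans (≈⇒∼ u≈) (trans (sym (edge e∈)) (Reach-elim sym trans ≈⇒∼ edge rest))

module Reachability (G : Graph) {_≈_ : VRel G} (≈-isEquivalence : IsEquivalence _≈_) where
  open IsEquivalence ≈-isEquivalence renaming (refl to ≈-refl; sym to ≈-sym; trans to ≈-trans)

  private
    variable
      F F′ : Subset (m G)
      e : Fin (m G)
      u v w : Fin (n G)

  _~[_]_ : Fin (n G) → Subset (m G) → Fin (n G) → Set
  u ~[ F ] v = Reach G _≈_ F u v

  ~-refl : u ~[ F ] u
  ~-refl = here ≈-refl

  ~-trans : u ~[ F ] v → v ~[ F ] w → u ~[ F ] w
  ~-trans (here u≈v) (here v≈w)          = here (≈-trans u≈v v≈w)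
  ~-trans (here u≈v) (fwd e e∈ v≈ rest)  = fwd e e∈ (≈-trans u≈v v≈) rest
  ~-trans (here u≈v) (bwd e e∈ v≈ rest)  = bwd e e∈ (≈-trans u≈v v≈) rest
  ~-trans (fwd e e∈ u≈ rest) q           = fwd e e∈ u≈ (~-trans rest q)
  ~-trans (bwd e e∈ u≈ rest) q           = bwd e e∈ u≈ (~-trans rest q)

  ~-sym : u ~[ F ] v → v ~[ F ] u
  ~-sym (here u≈v)         = here (≈-sym u≈v)
  ~-sym (fwd e e∈ u≈ rest) = ~-trans (~-sym rest) (bwd e e∈ ≈-refl (here (≈-sym u≈)))
  ~-sym (bwd e e∈ u≈ rest) = ~-trans (~-sym rest) (fwd e e∈ ≈-refl (here (≈-sym u≈)))

  ~-edge : e ∈ F → src G e ~[ F ] tgt G e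
  ~-edge e∈ = fwd _ e∈ ≈-refl (here ≈-refl)

  ~-mono : F ⊆ F′ → u ~[ F ] v → u ~[ F′ ] v
  ~-mono F⊆F′ = Reach-map G (λ u≈v → u≈v) F⊆F′

  Empty⇒~⇒≈ : Empty F → u ~[ F ] v → u ≈ v
  Empty⇒~⇒≈ empty u~v = Reach-elim G ≈-sym ≈-trans (λ u≈v → u≈v) (λ e∈ → ⊥-elim (empty (_ , e∈))) u~v

  _~[_+_]_ : Fin (n G) → Subset (m G) → Fin (m G) → Fin (n G) → Set
  u ~[ F + e ] v = u ~[ F ] v
                 ⊎ (u ~[ F ] src G e × tgt G e ~[ F ] v)
                 ⊎ (u ~[ F ] tgt G e × src G e ~[ F ] v)

  ~+-sym : u ~[ F + e ] v → v ~[ F + e ] u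
  ~+-sym (inj₁ uv)               = inj₁ (~-sym uv)
  ~+-sym (inj₂ (inj₁ (us , tv))) = inj₂ (inj₂ (~-sym tv , ~-sym us))
  ~+-sym (inj₂ (inj₂ (ut , sv))) = inj₂ (inj₁ (~-sym sv , ~-sym ut))

  ~+-trans : u ~[ F + e ] v → v ~[ F + e ] w → u ~[ F + e ] w
  ~+-trans (inj₁ uv)               (inj₁ vw)               = inj₁ (~-trans uv vw)
  ~+-trans (inj₁ uv)               (inj₂ (inj₁ (vs , tw))) = inj₂ (inj₁ (~-trans uv vs , tw))
  ~+-trans (inj₁ uv)               (inj₂ (inj₂ (vt , sw))) = inj₂ (inj₂ (~-trans uv vt , sw))
  ~+-trans (inj₂ (inj₁ (us , tv))) (inj₁ vw)               = inj₂ (inj₁ (us , ~-trans tv vw))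
  ~+-trans (inj₂ (inj₁ (us , _)))  (inj₂ (inj₁ (_ , tw)))  = inj₂ (inj₁ (us , tw))
  ~+-trans (inj₂ (inj₁ (us , _)))  (inj₂ (inj₂ (_ , sw)))  = inj₁ (~-trans us sw)
  ~+-trans (inj₂ (inj₂ (ut , sv))) (inj₁ vw)               = inj₂ (inj₂ (ut , ~-trans sv vw))
  ~+-trans (inj₂ (inj₂ (ut , _)))  (inj₂ (inj₁ (_ , tw)))  = inj₁ (~-trans ut tw)
  ~+-trans (inj₂ (inj₂ (ut , _)))  (inj₂ (inj₂ (_ , sw)))  = inj₂ (inj₂ (ut , sw))

  ~-split : F ⊆ F′ ∪ ⁅ e ⁆ → u ~[ F ] v → u ~[ F′ + e ] v
  ~-split {F} {F′} {e} F⊆ u~v = Reach-elim G ~+-sym ~+-trans (λ u≈v → inj₁ (here u≈v)) edge u~v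
    where
    edge : ∀ {g} → g ∈ F → src G g ~[ F′ + e ] tgt G g
    edge {g} g∈ with x∈p∪q⁻ F′ ⁅ e ⁆ (F⊆ g∈)
    ... | inj₁ g∈F′ = inj₁ (~-edge g∈F′)
    ... | inj₂ g∈⁅e⁆ with x∈⁅y⁆⇒x≡y e g∈⁅e⁆
    ...   | refl = inj₂ (inj₁ (~-refl , ~-refl))

  ~+⇒~ : F′ ⊆ F → e ∈ F → u ~[ F′ + e ] v → u ~[ F ] v
  ~+⇒~ F′⊆F e∈ (inj₁ uv) = ~-mono F′⊆F uv
  ~+⇒~ F′⊆F e∈ (inj₂ (inj₁ (us , tv))) =
    ~-trans (~-mono F′⊆F us) (~-trans (~-edge e∈) (~-mono F′⊆F tv))
  ~+⇒~ F′⊆F e∈ (inj₂ (inj₂ (ut , sv))) =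
    ~-trans (~-mono F′⊆F ut) (~-trans (~-sym (~-edge e∈)) (~-mono F′⊆F sv))

  ~-decidable : Decidable _≈_ → ∀ F → Decidable _~[ F ]_
  ~-decidable _≈?_ = removal-induction (λ F → Decidable _~[ F ]_) empty step
    where
    empty : Empty F → Decidable _~[ F ]_
    empty emp u v = map′ here (Empty⇒~⇒≈ emp) (u ≈? v)

    step : ∀ {F x} → x ∈ F → Decidable _~[ F - x ]_ → Decidable _~[ F ]_
    step {F} {x} x∈ _~?_ u v =
      map′ (~+⇒~ (p─q⊆p F ⁅ x ⁆) x∈) (~-split p⊆p-x∪⁅x⁆)
        (u ~? v ⊎-dec (u ~? src G x ×-dec tgt G x ~? v) ⊎-dec (u ~? tgt G x ×-dec src G x ~? v))

  -- A cycle through a forest edge f and e would join the ends of e inside F.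
  Forest-∪⁅⁆ : Forest G _≈_ F → ¬ src G e ~[ F ] tgt G e → Forest G _≈_ (F ∪ ⁅ e ⁆)
  Forest-∪⁅⁆ {F} {e} forest ¬st f f∈ st with f ≟ᶠ e
  ... | yes refl = ¬st (~-mono p∪⁅x⁆-x⊆p st)
  ... | no f≢e with x∈p∪q⁻ F ⁅ e ⁆ f∈
  ...   | inj₂ f∈⁅e⁆ = f≢e (x∈⁅y⁆⇒x≡y e f∈⁅e⁆)
  ...   | inj₁ f∈F with ~-split p∪⁅x⁆-y⊆p-y∪⁅x⁆ st
  ...     | inj₁ st′ = forest f f∈F st′
  ...     | inj₂ (inj₁ (sf~se , te~tf)) =
              ¬st (~+⇒~ (p─q⊆p F ⁅ f ⁆) f∈F (inj₂ (inj₁ (~-sym sf~se , ~-sym te~tf))))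
  ...     | inj₂ (inj₂ (sf~te , se~tf)) =
              ¬st (~+⇒~ (p─q⊆p F ⁅ f ⁆) f∈F (inj₂ (inj₂ (se~tf , sf~te))))

  Forest-∪⁅⁆⇒≁ : e ∉ F → Forest G _≈_ (F ∪ ⁅ e ⁆) → ¬ src G e ~[ F ] tgt G e
  Forest-∪⁅⁆⇒≁ {e} e∉F forest st =
    forest e (x∈p∪q⁺ (inj₂ (x∈⁅x⁆ e))) (~-mono (x∉p⇒p⊆p∪⁅x⁆-x e∉F) st)

  CycleBasis⇔Forest×Spans : Decidable _~[ F ]_ →
    CycleBasis G _≈_ F ⇔ (Forest G _≈_ F × Spans G _≈_ F)
  CycleBasis⇔Forest×Spans {F} _~?_ = mk⇔ basis⇒ ⇒basis
    where
    basis⇒ : CycleBasis G _≈_ F → Forest G _≈_ F × Spans G _≈_ F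
    basis⇒ (forest , maximal) = forest , spans
      where
      spans : Spans G _≈_ F
      spans e with src G e ~? tgt G e | e ∈? F
      ... | yes st | _       = st
      ... | no ¬st | yes e∈F = ⊥-elim (¬st (~-edge e∈F))
      ... | no ¬st | no e∉F  = ⊥-elim (maximal e e∉F (Forest-∪⁅⁆ forest ¬st))

    ⇒basis : Forest G _≈_ F × Spans G _≈_ F → CycleBasis G _≈_ F
    ⇒basis (forest , spans) = forest , λ e e∉F forest′ → Forest-∪⁅⁆⇒≁ e∉F forest′ (spans e)

  Spans⇒connected⇒~ : Spans G _≈_ F → Reach G _≡_ full u v → u ~[ F ] v
  Spans⇒connected⇒~ spans = Reach-elim G ~-sym ~-trans (λ { refl → ~-refl }) (λ {e} _ → spans e)

module Identification (G : Graph) (T : Subset (n G)) where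

  IdentT-isEquivalence : IsEquivalence (IdentT G T)
  IdentT-isEquivalence = record
    { refl  = inj₁ refl
    ; sym   = λ { (inj₁ refl) → inj₁ refl ; (inj₂ (uT , vT)) → inj₂ (vT , uT) }
    ; trans = λ { (inj₁ refl) v≈w → v≈w
                ; u≈v (inj₁ refl) → u≈v
                ; (inj₂ (uT , _)) (inj₂ (_ , wT)) → inj₂ (uT , wT) }
    }

  open Reachability G isEquivalence
  module G/T = Reachability G IdentT-isEquivalence

  private
    variable
      F : Subset (m G)
      u v w : Fin (n G)

  ≡⇒G/T : u ~[ F ] v → u G/T.~[ F ] v
  ≡⇒G/T = Reach-map G inj₁ (λ e∈ → e∈)

  ReachesT : Subset (m G) → Fin (n G) → Set
  ReachesT F u = ∃ λ a → a ∈ T × u ~[ F ] a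

  ~-ReachesT : u ~[ F ] v → ReachesT F v → ReachesT F u
  ~-ReachesT u~v (a , aT , v~a) = a , aT , ~-trans u~v v~a

  Joined : Subset (m G) → Fin (n G) → Fin (n G) → Set
  Joined F u v = u ~[ F ] v ⊎ (ReachesT F u × ReachesT F v)

  Joined-sym : Joined F u v → Joined F v u
  Joined-sym (inj₁ u~v)       = inj₁ (~-sym u~v)
  Joined-sym (inj₂ (uT , vT)) = inj₂ (vT , uT)

  Joined-trans : Joined F u v → Joined F v w → Joined F u w
  Joined-trans (inj₁ u~v)       (inj₁ v~w)       = inj₁ (~-trans u~v v~w)
  Joined-trans (inj₁ u~v)       (inj₂ (vT , wT)) = inj₂ (~-ReachesT u~v vT , wT)
  Joined-trans (inj₂ (uT , vT)) (inj₁ v~w)       = inj₂ (uT , ~-ReachesT (~-sym v~w) vT)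
  Joined-trans (inj₂ (uT , _))  (inj₂ (_ , wT))  = inj₂ (uT , wT)

  G/T-~⇔Joined : u G/T.~[ F ] v ⇔ Joined F u v
  G/T-~⇔Joined = mk⇔ (Reach-elim G Joined-sym Joined-trans identified (λ e∈ → inj₁ (~-edge e∈))) joined⇒
    where
    identified : IdentT G T u v → Joined F u v
    identified (inj₁ refl)       = inj₁ ~-refl
    identified (inj₂ (uT , vT)) = inj₂ ((_ , uT , ~-refl) , (_ , vT , ~-refl))

    joined⇒ : Joined F u v → u G/T.~[ F ] v
    joined⇒ (inj₁ u~v) = ≡⇒G/T u~v
    joined⇒ (inj₂ ((a , aT , u~a) , (b , bT , v~b))) =
      G/T.~-trans (≡⇒G/T u~a) (G/T.~-trans (here (inj₂ (aT , bT))) (G/T.~-sym (≡⇒G/T v~b)))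

  ReachesT? : ∀ F u → Dec (ReachesT F u)
  ReachesT? F u = any? λ a → a ∈? T ×-dec ~-decidable _≟ᶠ_ F u a

  G/T-~-decidable : ∀ F → Decidable G/T._~[ F ]_
  G/T-~-decidable F u v = map′ (from G/T-~⇔Joined) (to G/T-~⇔Joined)
    (~-decidable _≟ᶠ_ F u v ⊎-dec (ReachesT? F u ×-dec ReachesT? F v))

  Separated : Subset (m G) → Set
  Separated F = ∀ {a b} → a ∈ T → b ∈ T → a ~[ F ] b → a ≡ b

  Forest-IdentT⇒Separated : Forest G (IdentT G T) F → Separated F
  Forest-IdentT⇒Separated {F} forest = removal-induction P empty step F (λ e∈ → e∈)
    where
    P : Subset (m G) → Set
    P S = S ⊆ F → Separated S

    empty : ∀ {S} → Empty S → P S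
    empty emp _ _ _ a~b = Empty⇒~⇒≈ emp a~b

    lift : ∀ {S e} → S ⊆ F → u ~[ S - e ] v → u ~[ F - e ] v
    lift S⊆F = ~-mono (p⊆q⇒p-x⊆q-x S⊆F)

    acyclic : ∀ {e} → e ∈ F → ¬ Joined (F - e) (src G e) (tgt G e)
    acyclic e∈F joined = forest _ e∈F (from G/T-~⇔Joined joined)

    step : ∀ {S e} → e ∈ S → P (S - e) → P S
    step {S} {e} e∈S ih S⊆F aT bT a~b with ~-split p⊆p-x∪⁅x⁆ a~b
    ... | inj₁ a~b′ = ih (λ g∈ → S⊆F (p─q⊆p S ⁅ e ⁆ g∈)) aT bT a~b′
    ... | inj₂ (inj₁ (a~s , t~b)) =
          ⊥-elim (acyclic (S⊆F e∈S) (inj₂ ((_ , aT , ~-sym (lift S⊆F a~s)) , (_ , bT , lift S⊆F t~b))))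
    ... | inj₂ (inj₂ (a~t , s~b)) =
          ⊥-elim (acyclic (S⊆F e∈S) (inj₂ ((_ , bT , lift S⊆F s~b) , (_ , aT , ~-sym (lift S⊆F a~t)))))

  Forest-IdentT⇔Forest×Separated : Forest G (IdentT G T) F ⇔ (Forest G _≡_ F × Separated F)
  Forest-IdentT⇔Forest×Separated {F} = mk⇔ forestT⇒ ⇒forestT
    where
    forestT⇒ : Forest G (IdentT G T) F → Forest G _≡_ F × Separated F
    forestT⇒ forest = (λ f f∈ st → forest f f∈ (≡⇒G/T st)) , Forest-IdentT⇒Separated forest

    ⇒forestT : Forest G _≡_ F × Separated F → Forest G (IdentT G T) F
    ⇒forestT (forest , separated) f f∈ st with to G/T-~⇔Joined st
    ... | inj₁ st′ = forest f f∈ st′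
    ... | inj₂ ((a , aT , s~a) , (b , bT , t~b))
          with separated aT bT (~+⇒~ (p─q⊆p F ⁅ f ⁆) f∈ (inj₂ (inj₁ (~-sym s~a , t~b))))
    ...   | refl = forest f f∈ (~-trans s~a (~-sym t~b))

  OddT⇒ReachesT : OddT G T F v → ReachesT F v
  OddT⇒ReachesT ([] , _ , _ , ())
  OddT⇒ReachesT (a ∷ _ , _ , L⇔ , _) = a , to (L⇔ a) (here refl)

  TSpanning⇒Separated : ∣ T ∣ ≤ 2 → TSpanning G T F → Separated F
  TSpanning⇒Separated ∣T∣≤2 tspanning {a} {b} aT bT a~b with tspanning a
  ... | inj₂ (noT , _) = ⊥-elim (noT a aT ~-refl)
  ... | inj₁ (L , unique , L⇔ , odd) =
        ∈-odd-length≤2⇒≡ (≤-trans (length≤∣p∣ T unique (λ x∈ → proj₁ (to (L⇔ _) x∈))) ∣T∣≤2) odd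
          (from (L⇔ a) (aT , ~-refl)) (from (L⇔ b) (bT , a~b))

  TSpanning⇒Spans : TSpanning G T F → Spans G (IdentT G T) F
  TSpanning⇒Spans tspanning e with tspanning (src G e) | tspanning (tgt G e)
  ... | inj₂ (_ , s-component) | _ = ≡⇒G/T (s-component _ (~-edge ∈⊤))
  ... | _ | inj₂ (_ , t-component) = G/T.~-sym (≡⇒G/T (t-component _ (~-sym (~-edge ∈⊤))))
  ... | inj₁ s-odd | inj₁ t-odd =
        from G/T-~⇔Joined (inj₂ (OddT⇒ReachesT s-odd , OddT⇒ReachesT t-odd))

  Separated×Spans⇒TSpanning : Separated F → Spans G (IdentT G T) F → TSpanning G T F
  Separated×Spans⇒TSpanning {F} separated spans v with ReachesT? F v
  ... | yes (a , aT , v~a) = inj₁ (a ∷ [] , [] ∷ [] , L⇔ , refl)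
    where
    L⇔ : ∀ w → (w ∈ₗ a ∷ []) ⇔ (w ∈ T × v ~[ F ] w)
    L⇔ w = mk⇔ (λ { (here refl) → aT , v~a })
                (λ (wT , v~w) → here (sym (separated aT wT (~-trans (~-sym v~a) v~w))))
  ... | no ¬reachesT = inj₂ ((λ w wT v~w → ¬reachesT (w , wT , v~w)) , component)
    where
    component : IsGComponent G T F v
    component w connected with to G/T-~⇔Joined (G/T.Spans⇒connected⇒~ spans connected)
    ... | inj₁ v~w            = v~w
    ... | inj₂ (reachesT , _) = ⊥-elim (¬reachesT reachesT)

lemma3p3 : (G : Graph) (T : Subset (n G)) → ∣ T ∣ ≤ 2 →
    ∀ (F : Subset (m G)) → Feasible G T F ⇔ CycleBasis G (IdentT G T) F
lemma3p3 G T ∣T∣≤2 F = mk⇔ feasible⇒ ⇒feasible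
  where
  open Identification G T

  basis⇔ : CycleBasis G (IdentT G T) F ⇔ (Forest G (IdentT G T) F × Spans G (IdentT G T) F)
  basis⇔ = G/T.CycleBasis⇔Forest×Spans (G/T-~-decidable F)

  feasible⇒ : Feasible G T F → CycleBasis G (IdentT G T) F
  feasible⇒ (forest , tspanning) = from basis⇔
    ( from Forest-IdentT⇔Forest×Separated (forest , TSpanning⇒Separated ∣T∣≤2 tspanning)
    , TSpanning⇒Spans tspanning )

  ⇒feasible : CycleBasis G (IdentT G T) F → Feasible G T F
  ⇒feasible basis with to basis⇔ basis
  ... | forestT , spans with to Forest-IdentT⇔Forest×Separated forestT
  ...   | forest , separated = forest , Separated×Spans⇒TSpanning separated spans
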